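{- Let $n$ and $N$ be positive even integers with $N\ge n$, and let $P\in\{P_n^{<,<},P_n^{>,>}\}$. Then \[ \mathrm{ex}_<(N,P)\le nN\left(\log_2(N/n)+2\right). \]
   Context: An ordered graph is a graph whose vertex set is equipped with a total order; an $N$-vertex ordered graph is identified with a graph on $[N]=\{1,\dots,N\}$ ordered as the integers. An ordered graph $G$ contains an ordered graph $H$ if there is an injection $f:V(H)\to V(G)$ such that $f(i)<f(j)$ whenever $i<j$, and $f(i)f(j)\in E(G)$ whenever $ij\in E(H)$; otherwise $G$ avoids $H$. The ordered Turán number $\mathrm{ex}_<(N,H)$ is the maximum number of edges of an ordered graph on $[N]$ avoiding $H$. For $n=2k$ even: $P_n^{<,<}$ is the ordered path on $[n]$ with vertex sequence $v_1,\dots,v_n$ along the path given by $v_{2j-1}=j$, $v_{2j}=k+j$ ($j=1,\dots,k$); and $P_n^{>,>}$ is the ordered path on $[n]$ with vertex sequence given by $v_{2j-1}=k+1-j$, $v_{2j}=2k+1-j$ ($j=1,\dots,k$). -}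

module Defs where

open import Data.Nat using (ℕ; zero; suc; _+_; _*_; _∸_; _^_; _≤_; _<_; _≡ᵇ_; _<ᵇ_; ⌊_/2⌋; _%_)
open import Data.Bool using (Bool; true; false; if_then_else_; _∧_; _∨_)
open import Data.Fin using (Fin; toℕ) renaming (_<_ to _<ᶠ_)
open import Data.List using (List; allFin; applyUpTo; map)
open import Data.Nat.ListAction using (sum)
open import Data.Bool.ListAction using (any)
open import Data.Product using (Σ; _×_)
open import Relation.Binary.PropositionalEquality using (_≡_)

-- An ordered graph on [N], with vertex i+1 represented by (i : Fin N),
-- ordered as the integers; given by a symmetric irreflexive adjacency.
record OGraph (N : ℕ) : Set where
  field
    adj    : Fin N → Fin N → Bool
    symm   : ∀ i j → adj i j ≡ adj j i
    irrefl : ∀ i → adj i i ≡ false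
open OGraph public

edgeCount : {N : ℕ} → OGraph N → ℕ
edgeCount {N} G =
  sum (map (λ i → sum (map (λ j → if (toℕ i <ᵇ toℕ j) ∧ adj G i j then 1 else 0)
                           (allFin N)))
           (allFin N))

Contains : {N n : ℕ} → OGraph N → (Fin n → Fin n → Bool) → Set
Contains {N} {n} G h =
  Σ (Fin n → Fin N) λ f →
    (∀ i j → i <ᶠ j → f i <ᶠ f j) ×
    (∀ i j → h i j ≡ true → adj G (f i) (f j) ≡ true)

isOdd : ℕ → Bool
isOdd t = (t % 2) ≡ᵇ 1

-- Vertex sequences (1-indexed positions t, values in 1..2k), n = 2k.
-- P^{<,<}:  v_{2j-1} = j,        v_{2j} = k + j
seqLL : ℕ → ℕ → ℕ
seqLL k t = if isOdd t then suc ⌊ t /2⌋ else k + ⌊ t /2⌋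

-- P^{>,>}:  v_{2j-1} = k + 1 - j,  v_{2j} = 2k + 1 - j
seqGG : ℕ → ℕ → ℕ
seqGG k t = if isOdd t then k + 1 ∸ suc ⌊ t /2⌋ else 2 * k + 1 ∸ ⌊ t /2⌋

data PathType : Set where
  LL GG : PathType

pathSeq : PathType → ℕ → ℕ → ℕ
pathSeq LL = seqLL
pathSeq GG = seqGG

pathAdj : (v : ℕ → ℕ) (k : ℕ) → Fin (2 * k) → Fin (2 * k) → Bool
pathAdj v k a b =
  any (λ t → ((v t ≡ᵇ suc (toℕ a)) ∧ (v (suc t) ≡ᵇ suc (toℕ b)))
           ∨ ((v t ≡ᵇ suc (toℕ b)) ∧ (v (suc t) ≡ᵇ suc (toℕ a))))
      (applyUpTo suc (2 * k ∸ 1))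

orderedPath : PathType → (k : ℕ) → Fin (2 * k) → Fin (2 * k) → Bool
orderedPath P k = pathAdj (pathSeq P k) k

-- E ≤ n N (log₂(N/n) + 2), for 0 < n ≤ N, expressed without reals:
-- equivalent to 2^(E ∸ 2nN) · n^(nN) ≤ N^(nN).
Log2Bound : (n N E : ℕ) → Set
Log2Bound n N E = 2 ^ (E ∸ 2 * n * N) * n ^ (n * N) ≤ N ^ (n * N)

module Submission where

-- Cut an interval into a left part A and a right part B. A chain is a sequence of A–B edges in
-- which consecutive edges share one endpoint while the other endpoint moves up, alternately on
-- the left and on the right. A chain of 2k − 1 edges whose first move is on the left (right) is
-- a copy of P^{<,<} (P^{>,>}) on 2k vertices, and a chain of 2k edges contains both, so when G
-- avoids P every chain has fewer than 2k edges. Label a crossing edge by the longest chains of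
-- either kind starting with it. For two edges with a common left end, chains starting with the
-- upper one extend to chains starting with the lower one, and similarly for a common right end;
-- hence after splitting the edges according to which label is larger, one label strictly
-- decreases along every row and the other along every column, and at most 2k(|A| + |B|) edges
-- cross the cut. Halving recursively, with n = 2k, an interval of width w ≤ 2^d n spans at most
-- (1 + d) n w edges; the choice 2^d n ≤ N ≤ 2^(d+1) n gives the logarithmic bound.

open import Algebra.Properties.CommutativeSemigroup using (interchange)
open import Data.Bool.Base using (Bool; true; false; T; if_then_else_; _∧_; not)
open import Data.Bool.ListAction using (any)
open import Data.Bool.Properties using (T-∧; T-∨; T-≡; T-not-≡)
open import Data.Empty using (⊥-elim)
open import Data.Fin.Base as Fin using (Fin; toℕ; fromℕ<) renaming (_<_ to _<ᶠ_)
open import Data.Fin.Properties using (toℕ<n; fromℕ<-toℕ; toℕ-fromℕ<)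
open import Data.List.Base using (upTo; applyUpTo; map; allFin; tabulate)
open import Data.List.Properties using (map-tabulate)
open import Data.List.Relation.Unary.Any.Properties using (any⁺; any⁻; applyUpTo⁺; applyUpTo⁻)
open import Data.Nat.Base
open import Data.Nat.ListAction using (sum)
open import Data.Nat.Properties
open import Data.Nat.Tactic.RingSolver using (solve-∀)
open import Data.Product.Base using (Σ; ∃-syntax; _×_; _,_; proj₁; proj₂; map₂)
open import Data.Sum.Base as Sum using (_⊎_; inj₁; inj₂)
open import Function.Base using (id; _∘_)
open import Function.Bundles using (module Equivalence)
open import Relation.Binary.PropositionalEquality
open import Relation.Nullary using (¬_; contradiction; ofʸ; ofⁿ; yes; no)

open import Defs

open Equivalence using (to; from)

+-interchange : ∀ a b c d → a + b + (c + d) ≡ a + c + (b + d)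
+-interchange = interchange +-commutativeSemigroup

*-interchange : ∀ a b c d → a * b * (c * d) ≡ a * c * (b * d)
*-interchange = interchange *-commutativeSemigroup

2*m*n≡m*n+m*n : ∀ m n → 2 * m * n ≡ m * n + m * n
2*m*n≡m*n+m*n = solve-∀

<ᵇ-true : ∀ {m n} → m < n → (m <ᵇ n) ≡ true
<ᵇ-true {m} {n} m<n with m <ᵇ n | <ᵇ-reflects-< m n
... | true  | _       = refl
... | false | ofⁿ m≮n = contradiction m<n m≮n

<ᵇ-false : ∀ {m n} → n ≤ m → (m <ᵇ n) ≡ false
<ᵇ-false {m} {n} n≤m with m <ᵇ n | <ᵇ-reflects-< m n
... | false | _       = refl
... | true  | ofʸ m<n = contradiction n≤m (<⇒≱ m<n)

≡ᵇ∧≡ᵇ⇒≡×≡ : ∀ {p q r s} → T ((p ≡ᵇ q) ∧ (r ≡ᵇ s)) → p ≡ q × r ≡ s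
≡ᵇ∧≡ᵇ⇒≡×≡ {p} {q} {r} {s} h = let p≡q , r≡s = to T-∧ h in ≡ᵇ⇒≡ p q p≡q , ≡ᵇ⇒≡ r s r≡s

-- Sums over intervals

sumRange : ℕ → ℕ → (ℕ → ℕ) → ℕ
sumRange a zero    f = 0
sumRange a (suc w) f = f a + sumRange (suc a) w f

InRange : ℕ → ℕ → ℕ → Set
InRange a w x = a ≤ x × x < a + w

inRange-head : ∀ a w → InRange a (suc w) a
inRange-head a w = ≤-refl , m<m+n a z<s

inRange-tail : ∀ {a w x} → InRange (suc a) w x → InRange a (suc w) x
inRange-tail {a} {w} (a<x , x<) = <⇒≤ a<x , ≤-trans x< (≤-reflexive (sym (+-suc a w)))

sumRange-cong : ∀ a w {f g : ℕ → ℕ} → (∀ x → InRange a w x → f x ≡ g x) →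
                sumRange a w f ≡ sumRange a w g
sumRange-cong a zero    eq = refl
sumRange-cong a (suc w) eq =
  cong₂ _+_ (eq a (inRange-head a w)) (sumRange-cong (suc a) w (λ x r → eq x (inRange-tail r)))

sumRange-≤ : ∀ a w {f : ℕ → ℕ} {K} → (∀ x → InRange a w x → f x ≤ K) → sumRange a w f ≤ w * K
sumRange-≤ a zero    le = z≤n
sumRange-≤ a (suc w) le =
  +-mono-≤ (le a (inRange-head a w)) (sumRange-≤ (suc a) w (λ x r → le x (inRange-tail r)))

sumRange-zero : ∀ a w {f : ℕ → ℕ} → (∀ x → InRange a w x → f x ≡ 0) → sumRange a w f ≡ 0
sumRange-zero a w eq =
  n≤0⇒n≡0 (≤-trans (sumRange-≤ a w (λ x r → ≤-reflexive (eq x r))) (≤-reflexive (*-zeroʳ w)))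

sumRange-++ : ∀ a w₁ w₂ (f : ℕ → ℕ) →
              sumRange a (w₁ + w₂) f ≡ sumRange a w₁ f + sumRange (a + w₁) w₂ f
sumRange-++ a zero     w₂ f = cong (λ c → sumRange c w₂ f) (sym (+-identityʳ a))
sumRange-++ a (suc w₁) w₂ f = begin
  f a + sumRange (suc a) (w₁ + w₂) f
    ≡⟨ cong (f a +_) (sumRange-++ (suc a) w₁ w₂ f) ⟩
  f a + (sumRange (suc a) w₁ f + sumRange (suc a + w₁) w₂ f)
    ≡⟨ sym (+-assoc (f a) _ _) ⟩
  f a + sumRange (suc a) w₁ f + sumRange (suc a + w₁) w₂ f
    ≡⟨ cong (λ c → f a + sumRange (suc a) w₁ f + sumRange c w₂ f) (sym (+-suc a w₁)) ⟩
  f a + sumRange (suc a) w₁ f + sumRange (a + suc w₁) w₂ f ∎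
  where open ≡-Reasoning

sumRange-+ : ∀ a w (f g : ℕ → ℕ) →
             sumRange a w (λ x → f x + g x) ≡ sumRange a w f + sumRange a w g
sumRange-+ a zero    f g = refl
sumRange-+ a (suc w) f g =
  trans (cong (f a + g a +_) (sumRange-+ (suc a) w f g))
        (+-interchange (f a) (g a) (sumRange (suc a) w f) (sumRange (suc a) w g))

sumRange-swap : ∀ a w b v (h : ℕ → ℕ → ℕ) →
                sumRange a w (λ x → sumRange b v (h x)) ≡
                sumRange b v (λ y → sumRange a w (λ x → h x y))
sumRange-swap a zero    b v h = sym (sumRange-zero b v (λ _ _ → refl))
sumRange-swap a (suc w) b v h =
  trans (cong (sumRange b v (h a) +_) (sumRange-swap (suc a) w b v h))
        (sym (sumRange-+ b v (h a) (λ y → sumRange (suc a) w (λ x → h x y))))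

sum-tabulate : ∀ n a (f : Fin n → ℕ) (g : ℕ → ℕ) → (∀ i → f i ≡ g (a + toℕ i)) →
               sum (tabulate f) ≡ sumRange a n g
sum-tabulate zero    a f g eq = refl
sum-tabulate (suc n) a f g eq =
  cong₂ _+_ (trans (eq Fin.zero) (cong g (+-identityʳ a)))
            (sum-tabulate n (suc a) (f ∘ Fin.suc) g
               (λ i → trans (eq (Fin.suc i)) (cong g (+-suc a (toℕ i)))))

sum-allFin : ∀ n (f : Fin n → ℕ) (g : ℕ → ℕ) → (∀ i → f i ≡ g (toℕ i)) →
             sum (map f (allFin n)) ≡ sumRange 0 n g
sum-allFin n f g eq = trans (cong sum (map-tabulate id f)) (sum-tabulate n 0 f g eq)

-- Counting edges in intervals

indicator : Bool → ℕ
indicator b = if b then 1 else 0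

indicator≤1 : ∀ b → indicator b ≤ 1
indicator≤1 true  = ≤-refl
indicator≤1 false = z≤n

indicator-split : ∀ b c → indicator b ≡ indicator (b ∧ c) + indicator (b ∧ not c)
indicator-split false c     = refl
indicator-split true  true  = refl
indicator-split true  false = refl

sumRange-indicator-≤ : ∀ a w (P : ℕ → Bool) (L : ℕ → ℕ) {M} →
  (∀ x → InRange a w x → T (P x) → L x < M) →
  (∀ x y → InRange a w x → InRange a w y → x < y → T (P x) → T (P y) → L y < L x) →
  sumRange a w (λ x → indicator (P x)) ≤ M
sumRange-indicator-≤ a zero    P L bound decreasing = z≤n
sumRange-indicator-≤ a (suc w) P L bound decreasing with P a in eq
... | false = sumRange-indicator-≤ (suc a) w P L
                (λ x r → bound x (inRange-tail r))
                (λ x y r s → decreasing x y (inRange-tail r) (inRange-tail s))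
... | true  = ≤-trans (s≤s rest) (bound a (inRange-head a w) Pa)
  where
  Pa : T (P a)
  Pa = subst T (sym eq) _
  rest : sumRange (suc a) w (λ x → indicator (P x)) ≤ L a
  rest = sumRange-indicator-≤ (suc a) w P L
           (λ y r@(a<y , _) Py → decreasing a y (inRange-head a w) (inRange-tail r) a<y Pa Py)
           (λ x y r s → decreasing x y (inRange-tail r) (inRange-tail s))

edgesIn : (ℕ → ℕ → Bool) → ℕ → ℕ → ℕ
edgesIn e a w = sumRange a w λ x → sumRange a w λ y → indicator ((x <ᵇ y) ∧ e x y)

edgesAcross : (ℕ → ℕ → Bool) → ℕ → ℕ → ℕ → ℕ
edgesAcross e a w₁ w₂ = sumRange a w₁ λ x → sumRange (a + w₁) w₂ λ y → indicator (e x y)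

edgesIn-≤-square : ∀ e a w → edgesIn e a w ≤ w * w
edgesIn-≤-square e a w = begin
  edgesIn e a w  ≤⟨ sumRange-≤ a w (λ x _ → sumRange-≤ a w (λ y _ → indicator≤1 _)) ⟩
  w * (w * 1)    ≡⟨ cong (w *_) (*-identityʳ w) ⟩
  w * w          ∎
  where open ≤-Reasoning

edgesIn-++ : ∀ e a w₁ w₂ →
             edgesIn e a (w₁ + w₂) ≡ edgesIn e a w₁ + edgesIn e (a + w₁) w₂ + edgesAcross e a w₁ w₂
edgesIn-++ e a w₁ w₂ = begin
  edgesIn e a (w₁ + w₂)
    ≡⟨ sumRange-cong a (w₁ + w₂) (λ x _ → sumRange-++ a w₁ w₂ (h x)) ⟩
  sumRange a (w₁ + w₂) (λ x → toA x + toB x)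
    ≡⟨ sumRange-++ a w₁ w₂ _ ⟩
  sumRange a w₁ (λ x → toA x + toB x) + sumRange b w₂ (λ x → toA x + toB x)
    ≡⟨ cong₂ _+_ (sumRange-+ a w₁ toA toB) (sumRange-+ b w₂ toA toB) ⟩
  (edgesIn e a w₁ + sumRange a w₁ toB) + (sumRange b w₂ toA + edgesIn e b w₂)
    ≡⟨ cong₂ (λ p q → (edgesIn e a w₁ + p) + (q + edgesIn e b w₂)) forwards backwards ⟩
  (edgesIn e a w₁ + edgesAcross e a w₁ w₂) + (0 + edgesIn e b w₂)
    ≡⟨ rearrange (edgesIn e a w₁) (edgesAcross e a w₁ w₂) (edgesIn e b w₂) ⟩
  edgesIn e a w₁ + edgesIn e b w₂ + edgesAcross e a w₁ w₂ ∎
  where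
  open ≡-Reasoning
  b = a + w₁
  h : ℕ → ℕ → ℕ
  h x y = indicator ((x <ᵇ y) ∧ e x y)
  toA toB : ℕ → ℕ
  toA x = sumRange a w₁ (h x)
  toB x = sumRange b w₂ (h x)
  forwards : sumRange a w₁ toB ≡ edgesAcross e a w₁ w₂
  forwards = sumRange-cong a w₁ λ x (_ , x<b) → sumRange-cong b w₂ λ y (b≤y , _) →
    cong (λ c → indicator (c ∧ e x y)) (<ᵇ-true (<-≤-trans x<b b≤y))
  backwards : sumRange b w₂ toA ≡ 0
  backwards = sumRange-zero b w₂ λ x (b≤x , _) → sumRange-zero a w₁ λ y (_ , y<b) →
    cong (λ c → indicator (c ∧ e x y)) (<ᵇ-false (<⇒≤ (<-≤-trans y<b b≤x)))
  rearrange : ∀ p q r → p + q + (0 + r) ≡ p + r + q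
  rearrange = solve-∀

edgesIn-halving : ∀ e n → (∀ a w₁ w₂ → edgesAcross e a w₁ w₂ ≤ n * (w₁ + w₂)) →
                  ∀ d a w → w ≤ 2 ^ d * n → edgesIn e a w ≤ suc d * (n * w)
edgesIn-halving e n across zero a w w≤n = begin
  edgesIn e a w      ≤⟨ edgesIn-≤-square e a w ⟩
  w * w              ≤⟨ *-monoʳ-≤ w (≤-trans w≤n (≤-reflexive (+-identityʳ n))) ⟩
  w * n              ≡⟨ *-comm w n ⟩
  n * w              ≡⟨ sym (+-identityʳ (n * w)) ⟩
  1 * (n * w)        ∎
  where open ≤-Reasoning
edgesIn-halving e n across (suc d) a w w≤ = begin
  edgesIn e a w
    ≡⟨ cong (edgesIn e a) (sym halves) ⟩
  edgesIn e a (h₁ + h₂)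
    ≡⟨ edgesIn-++ e a h₁ h₂ ⟩
  edgesIn e a h₁ + edgesIn e (a + h₁) h₂ + edgesAcross e a h₁ h₂
    ≤⟨ +-mono-≤ (+-mono-≤ (recurse a h₁ (≤-trans (⌊n/2⌋≤⌈n/2⌉ w) h₂≤Q)) (recurse (a + h₁) h₂ h₂≤Q))
                (across a h₁ h₂) ⟩
  suc d * (n * h₁) + suc d * (n * h₂) + n * (h₁ + h₂)
    ≡⟨ collect (suc d) n h₁ h₂ ⟩
  suc (suc d) * (n * (h₁ + h₂))
    ≡⟨ cong (λ v → suc (suc d) * (n * v)) halves ⟩
  suc (suc d) * (n * w) ∎
  where
  open ≤-Reasoning
  recurse : ∀ a w → w ≤ 2 ^ d * n → edgesIn e a w ≤ suc d * (n * w)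
  recurse = edgesIn-halving e n across d
  Q h₁ h₂ : ℕ
  Q  = 2 ^ d * n
  h₁ = ⌊ w /2⌋
  h₂ = ⌈ w /2⌉
  halves : h₁ + h₂ ≡ w
  halves = ⌊n/2⌋+⌈n/2⌉≡n w
  h₂≤Q : h₂ ≤ Q
  h₂≤Q = ≤-trans (⌈n/2⌉-mono (≤-trans w≤ (≤-reflexive (2*m*n≡m*n+m*n (2 ^ d) n))))
                 (≤-reflexive (sym (n≡⌈n+n/2⌉ Q)))
  collect : ∀ c n h₁ h₂ → c * (n * h₁) + c * (n * h₂) + n * (h₁ + h₂) ≡ suc c * (n * (h₁ + h₂))
  collect = solve-∀

-- The logarithmic bound

^-distribʳ-* : ∀ m n o → (m * n) ^ o ≡ m ^ o * n ^ o
^-distribʳ-* m n zero    = refl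
^-distribʳ-* m n (suc o) =
  trans (cong (m * n *_) (^-distribʳ-* m n o)) (*-interchange m n (m ^ o) (n ^ o))

log2Bound-intro : ∀ n N E d → E ≤ (2 + d) * (n * N) → 2 ^ d * n ≤ N → Log2Bound n N E
log2Bound-intro n N E d E≤ 2ᵈn≤N = begin
  2 ^ (E ∸ 2 * n * N) * n ^ (n * N)   ≤⟨ *-monoˡ-≤ (n ^ (n * N)) (^-monoʳ-≤ 2 excess≤) ⟩
  2 ^ (d * (n * N)) * n ^ (n * N)     ≡⟨ cong (_* n ^ (n * N)) (sym (^-*-assoc 2 d (n * N))) ⟩
  (2 ^ d) ^ (n * N) * n ^ (n * N)     ≡⟨ sym (^-distribʳ-* (2 ^ d) n (n * N)) ⟩
  (2 ^ d * n) ^ (n * N)               ≤⟨ ^-monoˡ-≤ (n * N) 2ᵈn≤N ⟩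
  N ^ (n * N)                         ∎
  where
  open ≤-Reasoning
  expand : ∀ d n N → (2 + d) * (n * N) ≡ 2 * n * N + d * (n * N)
  expand = solve-∀
  excess≤ : E ∸ 2 * n * N ≤ d * (n * N)
  excess≤ = m≤n+o⇒m∸n≤o E (2 * n * N) (≤-trans E≤ (≤-reflexive (expand d n N)))

dyadicScale-+ : ∀ n t → 1 ≤ n → ∃[ d ] 2 ^ d * n ≤ n + t × n + t ≤ 2 ^ suc d * n
dyadicScale-+ n zero    _   = 0 , ≤-refl , +-monoʳ-≤ n z≤n
dyadicScale-+ n (suc t) 1≤n with dyadicScale-+ n t 1≤n
... | d , lower , upper with n + suc t ≤? 2 ^ suc d * n
...   | yes upper′   = d , ≤-trans lower (+-monoʳ-≤ n (n≤1+n t)) , upper′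
...   | no  n+1+t≰M = suc d , <⇒≤ (≰⇒> n+1+t≰M) , (begin
  n + suc t           ≡⟨ +-suc n t ⟩
  suc (n + t)         ≤⟨ s≤s upper ⟩
  suc M               ≤⟨ +-monoˡ-≤ M (≤-trans 1≤n (≤-trans (m≤m+n n t) upper)) ⟩
  M + M               ≡⟨ sym (2*m*n≡m*n+m*n (2 ^ suc d) n) ⟩
  2 ^ suc (suc d) * n ∎)
  where
  open ≤-Reasoning
  M : ℕ
  M = 2 ^ suc d * n

dyadicScale : ∀ {n N} → 1 ≤ n → n ≤ N → ∃[ d ] 2 ^ d * n ≤ N × N ≤ 2 ^ suc d * n
dyadicScale {n} 1≤n n≤N with m≤n⇒∃[o]m+o≡n n≤N
... | t , refl = dyadicScale-+ n t 1≤n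

-- Chains across a cut

longest : (ℕ → Bool) → ℕ → ℕ
longest Q zero    = zero
longest Q (suc K) = if Q (suc K) then suc K else longest Q K

longest-≤ : ∀ Q K → longest Q K ≤ K
longest-≤ Q zero    = z≤n
longest-≤ Q (suc K) with Q (suc K)
... | true  = ≤-refl
... | false = m≤n⇒m≤1+n (longest-≤ Q K)

longest-maximal : ∀ Q K t → t ≤ K → T (Q t) → t ≤ longest Q K
longest-maximal Q zero    zero    _     _  = z≤n
longest-maximal Q (suc K) t t≤1+K Qt with Q (suc K) in eq
... | true  = t≤1+K
... | false with m≤n⇒m<n∨m≡n t≤1+K
...   | inj₁ t<1+K = longest-maximal Q K t (s≤s⁻¹ t<1+K) Qt
...   | inj₂ refl  = ⊥-elim (subst T eq Qt)

longest-holds : ∀ Q K → 1 ≤ longest Q K → T (Q (longest Q K))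
longest-holds Q (suc K) 1≤ with Q (suc K) in eq
... | true  = subst T (sym eq) _
... | false = longest-holds Q K 1≤

longest-< : ∀ Q R K → (∀ t → T (Q (suc t)) → T (R (suc (suc t)))) → ¬ T (R (suc K)) →
            1 ≤ longest Q K → longest Q K < longest R K
longest-< Q R K extend R-short 1≤g = below (longest Q K) (longest-≤ Q K) (longest-holds Q K 1≤g) 1≤g
  where
  below : ∀ g → g ≤ K → T (Q g) → 1 ≤ g → g < longest R K
  below (suc g) g<K Qg _ with suc g <? K
  ... | yes g+1<K = longest-maximal R K (suc (suc g)) g+1<K (extend g Qg)
  ... | no  g+1≮K =
    ⊥-elim (R-short (subst (λ t → T (R (suc t))) (≤-antisym g<K (≮⇒≥ g+1≮K)) (extend g Qg)))

-- Opaque, so that the predicate p stays visible to unification in T (existsAbove x n p).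
opaque
  existsAbove : ℕ → ℕ → (ℕ → Bool) → Bool
  existsAbove x n p = any (λ y → (x <ᵇ y) ∧ p y) (upTo n)

  existsAbove⁺ : ∀ {x n p} y → x < y → y < n → T (p y) → T (existsAbove x n p)
  existsAbove⁺ y x<y y<n py = any⁺ _ (applyUpTo⁺ id (from T-∧ (<⇒<ᵇ x<y , py)) y<n)

  existsAbove⁻ : ∀ {x n p} → T (existsAbove x n p) → ∃[ y ] x < y × y < n × T (p y)
  existsAbove⁻ {x} {n} h with applyUpTo⁻ id (any⁻ _ (upTo n) h)
  ... | y , y<n , found with to T-∧ found
  ...   | x<y , py = y , <ᵇ⇒< x y x<y , y<n , py

existsAbove-map : ∀ {x n p q} → (∀ {y} → T (p y) → T (q y)) →
                  T (existsAbove x n p) → T (existsAbove x n q)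
existsAbove-map f h with existsAbove⁻ h
... | y , x<y , y<n , py = existsAbove⁺ y x<y y<n (f py)

linked : PathType → (ℕ → ℕ → Bool) → ℕ → ℕ → ℕ → ℕ → Bool
linked LL e i j i′ j′ = e i′ j
linked GG e i j i′ j′ = e i j′

-- Read in the order left 0, …, left (k − 1), right 0, …, right (k − 1), a ladder is an
-- embedded copy of orderedPath P k.
record Ladder (e : ℕ → ℕ → Bool) (P : PathType) (b k : ℕ) : Set where
  field
    left right : ℕ → ℕ
    left<b     : ∀ x → x < k → left x < b
    b≤right    : ∀ x → x < k → b ≤ right x
    left-step  : ∀ x → suc x < k → left x < left (suc x)
    right-step : ∀ x → suc x < k → right x < right (suc x)
    rung-adj   : ∀ x → x < k → T (e (left x) (right x))
    link-adj   : ∀ x → suc x < k → T (linked P e (left x) (right x) (left (suc x)) (right (suc x)))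
open Ladder

_◃_ : ℕ → (ℕ → ℕ) → ℕ → ℕ
(x ◃ f) zero    = x
(x ◃ f) (suc n) = f n

ladder-singleton : ∀ {e P b i j} → i < b → b ≤ j → T (e i j) → Ladder e P b 1
ladder-singleton {i = i} {j} i<b b≤j eij = record
  { left = λ _ → i ; right = λ _ → j
  ; left<b = λ _ _ → i<b ; b≤right = λ _ _ → b≤j
  ; left-step = λ { _ (s≤s ()) } ; right-step = λ { _ (s≤s ()) }
  ; rung-adj = λ _ _ → eij ; link-adj = λ { _ (s≤s ()) } }

ladder-∷ : ∀ {e P b k i j} (L : Ladder e P b k) → i < b → b ≤ j → i < left L 0 → j < right L 0 →
           T (e i j) → T (linked P e i j (left L 0) (right L 0)) → Ladder e P b (suc k)
ladder-∷ {i = i} {j} L i<b b≤j i<L j<L eij lij = record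
  { left = i ◃ left L ; right = j ◃ right L
  ; left<b     = λ { zero _ → i<b ; (suc x) x<k → left<b L x (s≤s⁻¹ x<k) }
  ; b≤right    = λ { zero _ → b≤j ; (suc x) x<k → b≤right L x (s≤s⁻¹ x<k) }
  ; left-step  = λ { zero _ → i<L ; (suc x) x<k → left-step L x (s≤s⁻¹ x<k) }
  ; right-step = λ { zero _ → j<L ; (suc x) x<k → right-step L x (s≤s⁻¹ x<k) }
  ; rung-adj   = λ { zero _ → eij ; (suc x) x<k → rung-adj L x (s≤s⁻¹ x<k) }
  ; link-adj   = λ { zero _ → lij ; (suc x) x<k → link-adj L x (s≤s⁻¹ x<k) } }

double : ℕ → ℕ
double zero    = zero
double (suc n) = suc (suc (double n))

double≡2* : ∀ n → double n ≡ 2 * n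
double≡2* zero    = refl
double≡2* (suc n) = cong suc (trans (cong suc (double≡2* n)) (sym (+-suc n (n + 0))))

double-cancel-< : ∀ {m n} → double m < double n → m < n
double-cancel-< {zero}  {suc n} _ = z<s
double-cancel-< {suc m} {suc n} h = s≤s (double-cancel-< (s≤s⁻¹ (s≤s⁻¹ h)))

module Cut (e : ℕ → ℕ → Bool) (a w₁ w₂ : ℕ) where

  b c : ℕ
  b = a + w₁
  c = b + w₂

  -- A chain of t edges starting with ij; its first move raises the left end for LL and the
  -- right end for GG, and its later left ends stay below b and right ends below c.
  chain : PathType → ℕ → ℕ → ℕ → Bool
  chain P  zero          i j = false
  chain P  (suc zero)    i j = e i j
  chain LL (suc (suc t)) i j = e i j ∧ existsAbove i b (λ i′ → chain GG (suc t) i′ j)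
  chain GG (suc (suc t)) i j = e i j ∧ existsAbove j c (λ j′ → chain LL (suc t) i j′)

  chain-truncate : ∀ P t {i j} → T (chain P (suc (suc t)) i j) → T (chain P (suc t) i j)
  chain-truncate LL zero    h = proj₁ (to T-∧ h)
  chain-truncate GG zero    h = proj₁ (to T-∧ h)
  chain-truncate LL (suc t) h = from T-∧ (map₂ (existsAbove-map (chain-truncate GG t)) (to T-∧ h))
  chain-truncate GG (suc t) h = from T-∧ (map₂ (existsAbove-map (chain-truncate LL t)) (to T-∧ h))

  chain-unfold : ∀ P t {i j} → T (chain P (suc (suc (suc t))) i j) →
    ∃[ i′ ] ∃[ j′ ] i < i′ × i′ < b × j < j′ ×
                    T (e i j) × T (linked P e i j i′ j′) × T (chain P (suc t) i′ j′)
  chain-unfold LL t h with to T-∧ h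
  ... | eij , more with existsAbove⁻ more
  ...   | i′ , i<i′ , i′<b , h′ with to T-∧ h′
  ...     | ei′j , more′ with existsAbove⁻ more′
  ...       | j′ , j<j′ , _ , h″ = i′ , j′ , i<i′ , i′<b , j<j′ , eij , ei′j , h″
  chain-unfold GG t h with to T-∧ h
  ... | eij , more with existsAbove⁻ more
  ...   | j′ , j<j′ , _ , h′ with to T-∧ h′
  ...     | eij′ , more′ with existsAbove⁻ more′
  ...       | i′ , i<i′ , i′<b , h″ = i′ , j′ , i<i′ , i′<b , j<j′ , eij , eij′ , h″

  chain⇒ladder : ∀ P t {i j} → i < b → b ≤ j → T (chain P (suc (double t)) i j) →
                 Σ (Ladder e P b (suc t)) λ L → left L 0 ≡ i × right L 0 ≡ j
  chain⇒ladder P zero    i<b b≤j h = ladder-singleton i<b b≤j h , refl , refl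
  chain⇒ladder P (suc t) i<b b≤j h with chain-unfold P (double t) h
  ... | i′ , j′ , i<i′ , i′<b , j<j′ , eij , lij , h′
    with chain⇒ladder P t i′<b (≤-trans b≤j (<⇒≤ j<j′)) h′
  ...   | L , refl , refl = ladder-∷ L i<b b≤j i<i′ j<j′ eij lij , refl , refl

  longChain⇒ladder : ∀ P Q t {i j} → i < b → b ≤ j → T (chain Q (suc (suc (double t))) i j) →
                     Ladder e P b (suc t)
  longChain⇒ladder LL LL t i<b b≤j h =
    proj₁ (chain⇒ladder LL t i<b b≤j (chain-truncate LL (double t) h))
  longChain⇒ladder GG GG t i<b b≤j h =
    proj₁ (chain⇒ladder GG t i<b b≤j (chain-truncate GG (double t) h))
  longChain⇒ladder LL GG t i<b b≤j h with existsAbove⁻ (proj₂ (to T-∧ h))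
  ... | j′ , j<j′ , _ , h′ = proj₁ (chain⇒ladder LL t i<b (≤-trans b≤j (<⇒≤ j<j′)) h′)
  longChain⇒ladder GG LL t i<b b≤j h with existsAbove⁻ (proj₂ (to T-∧ h))
  ... | i′ , _ , i′<b , h′ = proj₁ (chain⇒ladder GG t i′<b b≤j h′)

  module _ (K : ℕ) (1≤K : 1 ≤ K) (short : ∀ P {i j} → i < b → b ≤ j → ¬ T (chain P (suc K) i j)) where

    label : PathType → ℕ → ℕ → ℕ
    label P i j = longest (λ t → chain P t i j) K

    label-≥1 : ∀ P {i j} → T (e i j) → 1 ≤ label P i j
    label-≥1 P eij = longest-maximal _ K 1 1≤K eij

    label-row : ∀ {i j j′} → i < b → b ≤ j → j < j′ → j′ < c → T (e i j) → T (e i j′) →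
                label LL i j′ < label GG i j
    label-row i<b b≤j j<j′ j′<c eij eij′ =
      longest-< _ _ K (λ t h → from T-∧ (eij , existsAbove⁺ _ j<j′ j′<c h))
                (short GG i<b b≤j) (label-≥1 LL eij′)

    label-column : ∀ {i i′ j} → i < i′ → i′ < b → b ≤ j → T (e i j) → T (e i′ j) →
                   label GG i′ j < label LL i j
    label-column i<i′ i′<b b≤j eij ei′j =
      longest-< _ _ K (λ t h → from T-∧ (eij , existsAbove⁺ _ i<i′ i′<b h))
                (short LL (<-trans i<i′ i′<b) b≤j) (label-≥1 GG ei′j)

    rowwise columnwise : ℕ → ℕ → Bool
    rowwise    i j = e i j ∧ (label GG i j ≤ᵇ label LL i j)
    columnwise i j = e i j ∧ not (label GG i j ≤ᵇ label LL i j)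

    row-≤ : ∀ {i} → i < b → sumRange b w₂ (λ j → indicator (rowwise i j)) ≤ suc K
    row-≤ {i} i<b = sumRange-indicator-≤ b w₂ (rowwise i) (label GG i) (λ _ _ _ → s≤s (longest-≤ _ K))
      λ j j′ (b≤j , _) (_ , j′<c) j<j′ pj pj′ →
        let eij , _ = to T-∧ pj ; eij′ , GG≤LL = to T-∧ pj′ in
        ≤-<-trans (≤ᵇ⇒≤ _ _ GG≤LL) (label-row i<b b≤j j<j′ j′<c eij eij′)

    column-≤ : ∀ {j} → b ≤ j → sumRange a w₁ (λ i → indicator (columnwise i j)) ≤ suc K
    column-≤ {j} b≤j = sumRange-indicator-≤ a w₁ (λ i → columnwise i j) (λ i → label LL i j)
      (λ _ _ _ → s≤s (longest-≤ _ K))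
      λ i i′ _ (_ , i′<b) i<i′ pi pi′ →
        let eij , _ = to T-∧ pi ; ei′j , GG≰LL = to T-∧ pi′ in
        <-trans (≰⇒> (λ GG≤LL → subst T (to T-not-≡ GG≰LL) (≤⇒≤ᵇ GG≤LL)))
                (label-column i<i′ i′<b b≤j eij ei′j)

    edgesAcross-≤ : edgesAcross e a w₁ w₂ ≤ suc K * (w₁ + w₂)
    edgesAcross-≤ = begin
      edgesAcross e a w₁ w₂
        ≡⟨ sumRange-cong a w₁ (λ i _ → trans (sumRange-cong b w₂ (λ j _ → indicator-split (e i j) _))
                                             (sumRange-+ b w₂ _ _)) ⟩
      sumRange a w₁ (λ i → rows i + columns i)
        ≡⟨ sumRange-+ a w₁ rows columns ⟩
      sumRange a w₁ rows + sumRange a w₁ columns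
        ≡⟨ cong (sumRange a w₁ rows +_) (sumRange-swap a w₁ b w₂ λ i j → indicator (columnwise i j)) ⟩
      sumRange a w₁ rows + sumRange b w₂ (λ j → sumRange a w₁ λ i → indicator (columnwise i j))
        ≤⟨ +-mono-≤ (sumRange-≤ a w₁ λ i (_ , i<b) → row-≤ i<b)
                    (sumRange-≤ b w₂ λ j (b≤j , _) → column-≤ b≤j) ⟩
      w₁ * suc K + w₂ * suc K
        ≡⟨ sym (*-distribʳ-+ (suc K) w₁ w₂) ⟩
      (w₁ + w₂) * suc K
        ≡⟨ *-comm (w₁ + w₂) (suc K) ⟩
      suc K * (w₁ + w₂) ∎
      where
      open ≤-Reasoning
      rows columns : ℕ → ℕ
      rows    i = sumRange b w₂ λ j → indicator (rowwise i j)
      columns i = sumRange b w₂ λ j → indicator (columnwise i j)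

-- Embedding the path

adjℕ : ∀ {N} → OGraph N → ℕ → ℕ → Bool
adjℕ {N} G x y with x <? N | y <? N
... | yes x<N | yes y<N = adj G (fromℕ< x<N) (fromℕ< y<N)
... | _       | _       = false

adjℕ-bounded : ∀ {N} (G : OGraph N) {x y} → T (adjℕ G x y) → x < N × y < N
adjℕ-bounded {N} G {x} {y} h with x <? N | y <? N
... | yes x<N | yes y<N = x<N , y<N

adjℕ-fromℕ< : ∀ {N} (G : OGraph N) {x y} (x<N : x < N) (y<N : y < N) →
              adjℕ G x y ≡ adj G (fromℕ< x<N) (fromℕ< y<N)
adjℕ-fromℕ< {N} G {x} {y} x<N y<N with x <? N | y <? N
... | yes x<N′ | yes y<N′ =
  cong₂ (λ p q → adj G (fromℕ< p) (fromℕ< q)) (<-irrelevant x<N′ x<N) (<-irrelevant y<N′ y<N)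
... | no x≮N   | _        = contradiction x<N x≮N
... | yes _    | no y≮N   = contradiction y<N y≮N

adjℕ-toℕ : ∀ {N} (G : OGraph N) (i j : Fin N) → adjℕ G (toℕ i) (toℕ j) ≡ adj G i j
adjℕ-toℕ G i j = trans (adjℕ-fromℕ< G (toℕ<n i) (toℕ<n j))
                       (cong₂ (adj G) (fromℕ<-toℕ i (toℕ<n i)) (fromℕ<-toℕ j (toℕ<n j)))

adjℕ-sym : ∀ {N} (G : OGraph N) {x y} → T (adjℕ G x y) → T (adjℕ G y x)
adjℕ-sym G h with adjℕ-bounded G h
... | x<N , y<N =
  subst T (trans (adjℕ-fromℕ< G x<N y<N) (trans (symm G _ _) (sym (adjℕ-fromℕ< G y<N x<N)))) h

edgeCount≡edgesIn : ∀ {N} (G : OGraph N) → edgeCount G ≡ edgesIn (adjℕ G) 0 N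
edgeCount≡edgesIn {N} G =
  sum-allFin N _ _ λ i → sum-allFin N _ _ λ j →
    cong (λ c → indicator ((toℕ i <ᵇ toℕ j) ∧ c)) (sym (adjℕ-toℕ G i j))

-- The edges of orderedPath P k (vertices counted from 0) when vertex x < k is put at the
-- left end of rung x and vertex k + x at its right end.
data LadderEdge : PathType → ℕ → ℕ → ℕ → Set where
  rung   : ∀ {P k x} → x < k → LadderEdge P k x (k + x)
  linkLL : ∀ {k x} → suc x < k → LadderEdge LL k (suc x) (k + x)
  linkGG : ∀ {k x} → suc x < k → LadderEdge GG k x (k + suc x)

data EvenOdd : ℕ → Set where
  even : ∀ j → EvenOdd (double j)
  odd  : ∀ j → EvenOdd (suc (double j))

evenOdd : ∀ t → EvenOdd t
evenOdd zero    = even zero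
evenOdd (suc t) with evenOdd t
... | even j = odd j
... | odd  j = even (suc j)

alternate-odd : ∀ (f g : ℕ → ℕ) j →
  (if isOdd (suc (double j)) then f ⌊ suc (double j) /2⌋ else g ⌊ suc (double j) /2⌋) ≡ f j
alternate-odd f g zero    = refl
alternate-odd f g (suc j) = alternate-odd (f ∘ suc) (g ∘ suc) j

alternate-even : ∀ (f g : ℕ → ℕ) j →
  (if isOdd (double j) then f ⌊ double j /2⌋ else g ⌊ double j /2⌋) ≡ g j
alternate-even f g zero    = refl
alternate-even f g (suc j) = alternate-even (f ∘ suc) (g ∘ suc) j

∸≡suc∸suc : ∀ {m j} → j < m → m ∸ j ≡ suc (m ∸ suc j)
∸≡suc∸suc {suc m} {zero}  _   = refl
∸≡suc∸suc {suc m} {suc j} j<m = ∸≡suc∸suc (s≤s⁻¹ j<m)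

seqGG-low : ∀ k j → j < k → k + 1 ∸ suc j ≡ suc (k ∸ suc j)
seqGG-low k j j<k = trans (cong (_∸ suc j) (+-comm k 1)) (∸≡suc∸suc j<k)

seqGG-high : ∀ k j → j < k → 2 * k + 1 ∸ suc j ≡ suc (k + (k ∸ suc j))
seqGG-high k j j<k = begin
  2 * k + 1 ∸ suc j     ≡⟨ cong (_∸ suc j) (twice k) ⟩
  k + k ∸ j             ≡⟨ +-∸-assoc k (<⇒≤ j<k) ⟩
  k + (k ∸ j)           ≡⟨ cong (k +_) (∸≡suc∸suc j<k) ⟩
  k + suc (k ∸ suc j)   ≡⟨ +-suc k (k ∸ suc j) ⟩
  suc (k + (k ∸ suc j)) ∎
  where
  open ≡-Reasoning
  twice : ∀ k → 2 * k + 1 ≡ suc (k + k)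
  twice = solve-∀

pathSeq-step : ∀ P k t → t < double k ∸ 1 →
  ∃[ u ] ∃[ w ] pathSeq P k (suc t) ≡ suc u × pathSeq P k (suc (suc t)) ≡ suc w ×
                (LadderEdge P k u w ⊎ LadderEdge P k w u)
pathSeq-step LL k@(suc _) t t< with evenOdd t
... | even j = j , k + j , alternate-odd suc (k +_) j ,
                 trans (alternate-even suc (k +_) (suc j)) (+-suc k j) ,
                 inj₁ (rung (double-cancel-< (m<n⇒m<1+n t<)))
... | odd  j = k + j , suc j , trans (alternate-even suc (k +_) (suc j)) (+-suc k j) ,
                 alternate-odd suc (k +_) (suc j) ,
                 inj₂ (linkLL (s≤s (double-cancel-< (s≤s⁻¹ t<))))
pathSeq-step GG k@(suc _) t t< with evenOdd t
... | even j = k ∸ suc j , k + (k ∸ suc j) ,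
                 trans (alternate-odd low high j) (seqGG-low k j j<k) ,
                 trans (alternate-even low high (suc j)) (seqGG-high k j j<k) ,
                 inj₁ (rung (s≤s (m∸n≤m _ j)))
  where
  low high : ℕ → ℕ
  low  h = k + 1 ∸ suc h
  high h = 2 * k + 1 ∸ h
  j<k : j < k
  j<k = double-cancel-< (m<n⇒m<1+n t<)
... | odd  j = k + suc x , x ,
                 trans (alternate-even low high (suc j))
                       (trans (seqGG-high k j (<-trans (n<1+n j) 1+j<k)) (cong (λ y → suc (k + y)) 1+x≡)) ,
                 trans (alternate-odd low high (suc j)) (seqGG-low k (suc j) 1+j<k) ,
                 inj₂ (linkGG (subst (_< k) 1+x≡ (s≤s (m∸n≤m _ j))))
  where
  low high : ℕ → ℕ
  low  h = k + 1 ∸ suc h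
  high h = 2 * k + 1 ∸ h
  1+j<k : suc j < k
  1+j<k = s≤s (double-cancel-< (s≤s⁻¹ t<))
  x : ℕ
  x = k ∸ suc (suc j)
  1+x≡ : k ∸ suc j ≡ suc x
  1+x≡ = ∸≡suc∸suc 1+j<k

pathSeq-ladderEdge : ∀ P k t {x y} → t < 2 * k ∸ 1 →
  pathSeq P k (suc t) ≡ suc x → pathSeq P k (suc (suc t)) ≡ suc y →
  LadderEdge P k x y ⊎ LadderEdge P k y x
pathSeq-ladderEdge P k t t< seq-x seq-y
  with pathSeq-step P k t (subst (λ n → t < n ∸ 1) (sym (double≡2* k)) t<)
... | u , w , seq-u , seq-w , edge
  with suc-injective (trans (sym seq-x) seq-u) | suc-injective (trans (sym seq-y) seq-w)
...   | refl | refl = edge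

pathAdj-step : ∀ v k (a b : Fin (2 * k)) → pathAdj v k a b ≡ true →
  ∃[ t ] t < 2 * k ∸ 1 × (v (suc t) ≡ suc (toℕ a) × v (suc (suc t)) ≡ suc (toℕ b)
                        ⊎ v (suc t) ≡ suc (toℕ b) × v (suc (suc t)) ≡ suc (toℕ a))
pathAdj-step v k a b h with applyUpTo⁻ suc (any⁻ _ (applyUpTo suc (2 * k ∸ 1)) (from T-≡ h))
... | t , t< , found = t , t< , Sum.map ≡ᵇ∧≡ᵇ⇒≡×≡ ≡ᵇ∧≡ᵇ⇒≡×≡ (to T-∨ found)

orderedPath-ladderEdge : ∀ P k (a b : Fin (2 * k)) → orderedPath P k a b ≡ true →
                         LadderEdge P k (toℕ a) (toℕ b) ⊎ LadderEdge P k (toℕ b) (toℕ a)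
orderedPath-ladderEdge P k a b h with pathAdj-step (pathSeq P k) k a b h
... | t , t< , inj₁ (seq-a , seq-b) = pathSeq-ladderEdge P k t t< seq-a seq-b
... | t , t< , inj₂ (seq-b , seq-a) = Sum.swap (pathSeq-ladderEdge P k t t< seq-b seq-a)

stepwise-< : ∀ (f : ℕ → ℕ) {k} → (∀ x → suc x < k → f x < f (suc x)) →
             ∀ {x y} → x < y → y < k → f x < f y
stepwise-< f step {x} {suc y} x<1+y 1+y<k with m≤n⇒m<n∨m≡n (s≤s⁻¹ x<1+y)
... | inj₁ x<y  = <-trans (stepwise-< f step x<y (<-trans (n<1+n y) 1+y<k)) (step y 1+y<k)
... | inj₂ refl = step x 1+y<k

data Side (k : ℕ) : ℕ → Set where
  onLeft  : ∀ {x} → x < k → Side k x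
  onRight : ∀ x → Side k (k + x)

side : ∀ k v → Side k v
side k v with v <? k
... | yes v<k = onLeft v<k
... | no  v≮k = subst (Side k) (m+[n∸m]≡n (≮⇒≥ v≮k)) (onRight (v ∸ k))

right-half : ∀ k {x} → k + x < 2 * k → x < k
right-half k k+x<2k = subst (_ <_) (+-identityʳ k) (+-cancelˡ-< k _ _ k+x<2k)

module LadderEmbedding {N} (G : OGraph N) {P b k} (L : Ladder (adjℕ G) P b k) where

  vertex : ℕ → ℕ
  vertex v = if v <ᵇ k then left L v else right L (v ∸ k)

  vertex-left : ∀ {x} → x < k → vertex x ≡ left L x
  vertex-left x<k rewrite <ᵇ-true x<k = refl

  vertex-right : ∀ x → vertex (k + x) ≡ right L x
  vertex-right x rewrite <ᵇ-false (m≤m+n k x) | m+n∸m≡n k x = refl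

  vertex<N : ∀ {v} → v < 2 * k → vertex v < N
  vertex<N {v} v<2k with side k v
  ... | onLeft v<k = subst (_< N) (sym (vertex-left v<k)) (proj₁ (adjℕ-bounded G (rung-adj L v v<k)))
  ... | onRight x  = subst (_< N) (sym (vertex-right x))
                       (proj₂ (adjℕ-bounded G (rung-adj L x (right-half k v<2k))))

  vertex-< : ∀ {u v} → u < v → v < 2 * k → vertex u < vertex v
  vertex-< {u} {v} u<v v<2k with side k u | side k v
  ... | onLeft u<k | onLeft v<k rewrite vertex-left u<k | vertex-left v<k =
    stepwise-< (left L) (left-step L) u<v v<k
  ... | onLeft u<k | onRight y rewrite vertex-left u<k | vertex-right y =
    <-≤-trans (left<b L u u<k) (b≤right L y (right-half k v<2k))
  ... | onRight x  | onLeft v<k = contradiction (<-trans u<v v<k) (m+n≮m k x)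
  ... | onRight x  | onRight y rewrite vertex-right x | vertex-right y =
    stepwise-< (right L) (right-step L) (+-cancelˡ-< k _ _ u<v) (right-half k v<2k)

  vertex-adj : ∀ {u w} → LadderEdge P k u w → T (adjℕ G (vertex u) (vertex w))
  vertex-adj (rung {x = x} x<k) rewrite vertex-left x<k | vertex-right x = rung-adj L x x<k
  vertex-adj (linkLL {x = x} 1+x<k) rewrite vertex-left 1+x<k | vertex-right x = link-adj L x 1+x<k
  vertex-adj (linkGG {x = x} 1+x<k)
    rewrite vertex-left (<-trans (n<1+n x) 1+x<k) | vertex-right (suc x) = link-adj L x 1+x<k

  embed : Fin (2 * k) → Fin N
  embed v = fromℕ< (vertex<N (toℕ<n v))

  ladder⇒contains : Contains G (orderedPath P k)
  ladder⇒contains = embed , embed-< , embed-adj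
    where
    embed-< : ∀ u v → u <ᶠ v → embed u <ᶠ embed v
    embed-< u v u<v = subst₂ _<_ (sym (toℕ-fromℕ< _)) (sym (toℕ-fromℕ< _)) (vertex-< u<v (toℕ<n v))
    embed-adj : ∀ u v → orderedPath P k u v ≡ true → adj G (embed u) (embed v) ≡ true
    embed-adj u v h = trans (sym (adjℕ-fromℕ< G (vertex<N (toℕ<n u)) (vertex<N (toℕ<n v))))
      (to T-≡ (Sum.[ vertex-adj , adjℕ-sym G ∘ vertex-adj ] (orderedPath-ladderEdge P k u v h)))

theorem1p6 : (k m : ℕ) → 1 ≤ k → 2 * k ≤ 2 * m → (P : PathType) →
    (G : OGraph (2 * m)) → ¬ Contains G (orderedPath P k) →
    Log2Bound (2 * k) (2 * m) (edgeCount G)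
theorem1p6 k@(suc k′) m _ n≤N P G avoids with dyadicScale (s≤s z≤n) n≤N
... | d , 2ᵈn≤N , N≤2ᵈ⁺¹n =
  subst (Log2Bound n N) (sym (edgeCount≡edgesIn G))
        (log2Bound-intro n N _ d (edgesIn-halving e n across (suc d) 0 N N≤2ᵈ⁺¹n) 2ᵈn≤N)
  where
  n N : ℕ
  n = 2 * k
  N = 2 * m
  e : ℕ → ℕ → Bool
  e = adjℕ G
  across : ∀ a w₁ w₂ → edgesAcross e a w₁ w₂ ≤ n * (w₁ + w₂)
  across a w₁ w₂ = subst (λ c → edgesAcross e a w₁ w₂ ≤ c * (w₁ + w₂)) (double≡2* k)
    (edgesAcross-≤ (suc (double k′)) (s≤s z≤n) λ Q i<b b≤j long →
       avoids (LadderEmbedding.ladder⇒contains G (longChain⇒ladder P Q k′ i<b b≤j long)))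
    where open Cut e a w₁ w₂
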